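{- Let $f(t)=\sum_{m=0}^{\infty}a_m t^m$ be a formal power series with complex coefficients and let $z$ be an indeterminate. Then, as an identity of formal power series in $z$, $$\sum_{n=0}^{\infty}\frac{1}{2^{n+1}}\left\{\sum_{k=0}^n\binom{n}{k}(-1)^k f(zk)\right\} = \sum_{m=0}^{\infty}\frac{1-2^{m+1}}{m+1}\,a_m B_{m+1}\,z^m.$$
   Context: The Bernoulli numbers $B_n$ are defined by $\frac{t}{e^t-1}=\sum_{n\ge0}B_n\frac{t^n}{n!}$. The $n$-th bracket on the left is divisible by $z^n$, so the left side converges coefficientwise. -}

module Defs where

open import Level using (Level)
open import Data.Nat as ℕ using (ℕ; zero; suc; _∸_; _!)
open import Data.Nat.Properties using (_!≢0)
open import Data.Nat.Combinatorics using (_C_)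
open import Data.Fin using (Fin; toℕ; fromℕ)
open import Data.Vec using (Vec; []; _∷_; _∷ʳ_; lookup; tabulate; foldr′)
open import Data.Integer as ℤ using (ℤ; +_; -1ℤ)
open import Data.Rational using (ℚ; 0ℚ; 1ℚ; ½; _/_)
import Data.Rational as Q
open import Algebra.Bundles using (CommutativeRing)

infixr 8 _^ℚ_
_^ℚ_ : ℚ → ℕ → ℚ
p ^ℚ zero  = 1ℚ
p ^ℚ suc n = p Q.* (p ^ℚ n)

ℤ→ℚ : ℤ → ℚ
ℤ→ℚ z = z / 1

Σℚ : ℕ → (ℕ → ℚ) → ℚ
Σℚ zero    g = 0ℚ
Σℚ (suc n) g = Σℚ n g Q.+ g n

-- Bernoulli numbers, defined by t/(e^t - 1) = Σ B_n t^n / n!.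
-- Write (e^t - 1)/t = Σ_j c_j t^j with c_j = 1/(j+1)!  (c_0 = 1).
-- The inverse power series Σ b_n t^n of it is determined by
--   b_0 = 1,  b_n = - Σ_{k<n} b_k c_{n-k}  (n ≥ 1),
-- and B_n = n! · b_n.

expCoeff : ℕ → ℚ
expCoeff j = (+ 1 / (suc j) !) {{(suc j) !≢0}}

bVec : (n : ℕ) → Vec ℚ (suc n)
bVec zero    = 1ℚ ∷ []
bVec (suc n) = bVec n ∷ʳ
  (Q.- foldr′ Q._+_ 0ℚ
       (tabulate (λ (k : Fin (suc n)) →
          lookup (bVec n) k Q.* expCoeff (suc n ∸ toℕ k))))

bernoulli : ℕ → ℚ
bernoulli n = ℤ→ℚ (+ (n !)) Q.* lookup (bVec n) (fromℕ n)

-- Formal power series over a commutative ring R, together with a map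
-- ι : ℚ → R (assumed to be a ring homomorphism in the statement, i.e.
-- R is a ℚ-algebra, e.g. R = ℂ).

module Series {c ℓ : Level} (R : CommutativeRing c ℓ)
              (ι : ℚ → CommutativeRing.Carrier R) where

  open CommutativeRing R

  PowerSeries : Set c
  PowerSeries = ℕ → Carrier

  ΣR : ℕ → (ℕ → Carrier) → Carrier
  ΣR zero    g = 0#
  ΣR (suc n) g = ΣR n g + g n

  -- for f = Σ a_m t^m, the series in z:  f(z k) = Σ_m k^m a_m z^m
  substScale : PowerSeries → ℕ → PowerSeries
  substScale a k m = ι (ℤ→ℚ (+ (k ℕ.^ m))) * a m

  bracket : PowerSeries → ℕ → PowerSeries
  bracket a n m =
    ΣR (suc n) (λ k → ι (ℤ→ℚ ((-1ℤ ℤ.^ k) ℤ.* + (n C k))) * substScale a k m)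

  lhsPartial : PowerSeries → ℕ → PowerSeries
  lhsPartial a N m = ΣR N (λ n → ι (½ ^ℚ suc n) * bracket a n m)

  rhs : PowerSeries → PowerSeries
  rhs a m =
    ι ((1ℚ Q.- (ℤ→ℚ (+ 2)) ^ℚ suc m) Q.* (+ 1 / suc m) Q.* bernoulli (suc m)) * a m

module Submission where

-- Write diff n m = Σ_{k ≤ n} C(n,k) (-1)^k k^m.  The coefficient of z^m in
-- the n-th bracket is diff n m · a_m, so the coefficient of z^m in the N-th
-- partial sum is avg N m · a_m with avg N m = Σ_{n < N} 2^{-(n+1)} diff n m.
--
-- 1. Finite differences: diff (n+1) m = - Σ_{i<m} C(m,i) diff n i, hence
--    diff n m = 0 for m < n.  So avg N m is constant for N > m, equal to
--    E m = avg (m+1) m, and E satisfies 2·E m + Σ_{i<m} C(m,i) E i = [m = 0].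
-- 2. Read with exponential generating functions, this says
--    (Σ E_m t^m/m!)·(1 + e^t) = 1.  With β(t) = t/(e^t - 1) = Σ b_n t^n,
--    b_n = B_n/n!, the factorisation e^{2t} - 1 = (e^t - 1)(e^t + 1) gives
--    β(2t)(1 + e^t) = 2β(t), so ρ(t) = (β(t) - β(2t))/t also satisfies
--    ρ(t)(1 + e^t) = 1.  As 1 + e^t has invertible constant term,
--    E_m/m! = ρ_m = (1 - 2^{m+1}) b_{m+1}, i.e. E_m = (1-2^{m+1})/(m+1)·B_{m+1}.
-- 3. The ring homomorphism ι carries this rational identity to R.

open import Defs
open import Level using (Level)
open import Data.Nat as ℕ using (ℕ; zero; suc; _!; _<_; _≤_; _∸_; s≤s; NonZero)
import Data.Nat.Properties as NP
open import Data.Nat.Properties using (_!≢0; _!*_!≢0)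
open import Data.Nat.Combinatorics
  using (_C_; nCk+nC[k+1]≡[n+1]C[k+1]; k>n⇒nCk≡0; nCn≡1; nCk≡n!/k![n-k]!; k![n∸k]!∣n!)
import Data.Nat.DivMod as ND
open import Data.Fin using (Fin; toℕ; fromℕ) renaming (zero to fzero; suc to fsuc)
open import Data.Vec using (Vec; []; _∷_; _∷ʳ_; lookup; tabulate; foldr′)
open import Data.Integer as ℤ using (ℤ; -1ℤ)
import Data.Integer.Properties as ℤP
open import Data.Rational using (ℚ; 0ℚ; 1ℚ; ½; _/_; toℚᵘ; _+_; _*_; -_; _-_)
import Data.Rational as Q
import Data.Rational.Properties as QP
import Data.Rational.Unnormalised as U
import Data.Rational.Unnormalised.Properties as UP
open import Data.Rational.Solver using (module +-*-Solver)
open +-*-Solver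
open import Data.Product using (∃; _,_)
open import Data.Sum using (inj₁; inj₂)
open import Algebra.Bundles using (CommutativeRing)
open import Algebra.Morphism.Structures using (IsRingHomomorphism)
open import Relation.Binary.PropositionalEquality
open ≡-Reasoning

-- Casts ℤ → ℚ and ℕ → ℚ are ring homomorphisms.  ℚ is normalised, so the
-- arithmetic is checked on the unnormalised representatives.

ℤ→ℚ-toℚᵘ : ∀ z → toℚᵘ (ℤ→ℚ z) U.≃ U.mkℚᵘ z 0
ℤ→ℚ-toℚᵘ z = QP.toℚᵘ-fromℚᵘ (U.mkℚᵘ z 0)

ℤ→ℚ-+ : ∀ a b → ℤ→ℚ (a ℤ.+ b) ≡ ℤ→ℚ a + ℤ→ℚ b
ℤ→ℚ-+ a b = QP.toℚᵘ-injective (UP.≃-trans (ℤ→ℚ-toℚᵘ (a ℤ.+ b))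
  (UP.≃-trans sumᵘ (UP.≃-sym (UP.≃-trans (QP.toℚᵘ-homo-+ (ℤ→ℚ a) (ℤ→ℚ b))
                                          (UP.+-cong (ℤ→ℚ-toℚᵘ a) (ℤ→ℚ-toℚᵘ b))))))
  where
  sumᵘ : U.mkℚᵘ (a ℤ.+ b) 0 U.≃ U.mkℚᵘ a 0 U.+ U.mkℚᵘ b 0
  sumᵘ = U.*≡* (cong₂ (λ x y → (x ℤ.+ y) ℤ.* ℤ.+ 1) (sym (ℤP.*-identityʳ a)) (sym (ℤP.*-identityʳ b)))

ℤ→ℚ-* : ∀ a b → ℤ→ℚ (a ℤ.* b) ≡ ℤ→ℚ a * ℤ→ℚ b
ℤ→ℚ-* a b = QP.toℚᵘ-injective (UP.≃-trans (ℤ→ℚ-toℚᵘ (a ℤ.* b))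
  (UP.≃-trans (U.*≡* refl) (UP.≃-sym (UP.≃-trans (QP.toℚᵘ-homo-* (ℤ→ℚ a) (ℤ→ℚ b))
                                                   (UP.*-cong (ℤ→ℚ-toℚᵘ a) (ℤ→ℚ-toℚᵘ b))))))

-- ℕ→ℚ n is definitionally the cast used in Defs (e.g. inside 'bernoulli').
ℕ→ℚ : ℕ → ℚ
ℕ→ℚ n = ℤ→ℚ (ℤ.+ n)

ℕ→ℚ-+ : ∀ a b → ℕ→ℚ (a ℕ.+ b) ≡ ℕ→ℚ a + ℕ→ℚ b
ℕ→ℚ-+ a b = trans (cong ℤ→ℚ (ℤP.pos-+ a b)) (ℤ→ℚ-+ (ℤ.+ a) (ℤ.+ b))

ℕ→ℚ-* : ∀ a b → ℕ→ℚ (a ℕ.* b) ≡ ℕ→ℚ a * ℕ→ℚ b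
ℕ→ℚ-* a b = trans (cong ℤ→ℚ (ℤP.pos-* a b)) (ℤ→ℚ-* (ℤ.+ a) (ℤ.+ b))

ℕ→ℚ-^ : ∀ a m → ℕ→ℚ (a ℕ.^ m) ≡ ℕ→ℚ a ^ℚ m
ℕ→ℚ-^ a zero    = refl
ℕ→ℚ-^ a (suc m) = trans (ℕ→ℚ-* a (a ℕ.^ m)) (cong (ℕ→ℚ a *_) (ℕ→ℚ-^ a m))

recip-inverse : ∀ d .{{_ : NonZero d}} → (ℤ.+ 1 / d) * ℕ→ℚ d ≡ 1ℚ
recip-inverse (suc d) = QP.toℚᵘ-injective
  (UP.≃-trans (QP.toℚᵘ-homo-* (ℤ.+ 1 / suc d) (ℕ→ℚ (suc d)))
  (UP.≃-trans (UP.*-cong (QP.toℚᵘ-fromℚᵘ (U.mkℚᵘ (ℤ.+ 1) d)) (ℤ→ℚ-toℚᵘ (ℤ.+ suc d)))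
              (U.*≡* (trans (ℤP.*-identityʳ (ℤ.+ 1 ℤ.* ℤ.+ suc d))
                     (trans (ℤP.*-identityˡ (ℤ.+ suc d))
                     (sym (trans (ℤP.*-identityˡ (ℤ.+ suc d ℤ.* ℤ.+ 1)) (ℤP.*-identityʳ (ℤ.+ suc d)))))))))

sign : ℕ → ℚ
sign k = ℤ→ℚ (-1ℤ ℤ.^ k)

sign-suc : ∀ k → sign (suc k) ≡ - sign k
sign-suc k = trans (ℤ→ℚ-* -1ℤ (-1ℤ ℤ.^ k))
  (trans (sym (QP.neg-distribˡ-* 1ℚ (sign k))) (cong -_ (QP.*-identityˡ (sign k))))

two : ℚ
two = ℕ→ℚ 2

^ℚ-+ : ∀ p a k → p ^ℚ a * p ^ℚ k ≡ p ^ℚ (a ℕ.+ k)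
^ℚ-+ p zero    k = QP.*-identityˡ (p ^ℚ k)
^ℚ-+ p (suc a) k = trans (QP.*-assoc p (p ^ℚ a) (p ^ℚ k)) (cong (p *_) (^ℚ-+ p a k))

1^ℚ : ∀ i → 1ℚ ^ℚ i ≡ 1ℚ
1^ℚ zero    = refl
1^ℚ (suc i) = trans (QP.*-identityˡ _) (1^ℚ i)

Σ : ℕ → (ℕ → ℚ) → ℚ
Σ = Σℚ

Σ-cong : ∀ n {f g} → (∀ k → k < n → f k ≡ g k) → Σ n f ≡ Σ n g
Σ-cong zero    f≡g = refl
Σ-cong (suc n) f≡g = cong₂ _+_ (Σ-cong n (λ k k<n → f≡g k (NP.m<n⇒m<1+n k<n))) (f≡g n NP.≤-refl)

Σ-cong′ : ∀ n {f g} → (∀ k → f k ≡ g k) → Σ n f ≡ Σ n g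
Σ-cong′ n f≡g = Σ-cong n (λ k _ → f≡g k)

Σ-+ : ∀ n f g → Σ n (λ k → f k + g k) ≡ Σ n f + Σ n g
Σ-+ zero    f g = refl
Σ-+ (suc n) f g = begin
  Σ n (λ k → f k + g k) + (f n + g n) ≡⟨ cong (_+ (f n + g n)) (Σ-+ n f g) ⟩
  (Σ n f + Σ n g) + (f n + g n)
    ≡⟨ solve 4 (λ a b c d → (a :+ b) :+ (c :+ d) := (a :+ c) :+ (b :+ d)) refl (Σ n f) (Σ n g) (f n) (g n) ⟩
  (Σ n f + f n) + (Σ n g + g n) ∎

Σ-*ˡ : ∀ n c f → c * Σ n f ≡ Σ n (λ k → c * f k)
Σ-*ˡ zero    c f = QP.*-zeroʳ c
Σ-*ˡ (suc n) c f = trans (QP.*-distribˡ-+ c (Σ n f) (f n)) (cong (_+ c * f n) (Σ-*ˡ n c f))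

Σ-*ʳ : ∀ n c f → Σ n f * c ≡ Σ n (λ k → f k * c)
Σ-*ʳ n c f = trans (QP.*-comm (Σ n f) c) (trans (Σ-*ˡ n c f) (Σ-cong′ n (λ k → QP.*-comm c (f k))))

Σ-neg : ∀ n f → - Σ n f ≡ Σ n (λ k → - f k)
Σ-neg zero    f = refl
Σ-neg (suc n) f = trans (QP.neg-distrib-+ (Σ n f) (f n)) (cong (_+ - f n) (Σ-neg n f))

Σ-neg-weighted : ∀ n (w X : ℕ → ℚ) → Σ n (λ k → w k * - X k) ≡ - Σ n (λ k → w k * X k)
Σ-neg-weighted n w X = trans (Σ-cong′ n (λ k → sym (QP.neg-distribʳ-* (w k) (X k)))) (sym (Σ-neg n _))

Σ-zero : ∀ n f → (∀ k → k < n → f k ≡ 0ℚ) → Σ n f ≡ 0ℚ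
Σ-zero n f f≡0 = trans (Σ-cong n f≡0) (Σ-const0 n)
  where
  Σ-const0 : ∀ n → Σ n (λ _ → 0ℚ) ≡ 0ℚ
  Σ-const0 zero    = refl
  Σ-const0 (suc n) = trans (QP.+-identityʳ _) (Σ-const0 n)

Σ-first : ∀ n f → Σ (suc n) f ≡ f 0 + Σ n (λ k → f (suc k))
Σ-first zero    f = trans (QP.+-identityˡ (f 0)) (sym (QP.+-identityʳ (f 0)))
Σ-first (suc n) f = trans (cong (_+ f (suc n)) (Σ-first n f)) (QP.+-assoc (f 0) _ _)

Σ-swap : ∀ n m (F : ℕ → ℕ → ℚ) → Σ n (λ i → Σ m (F i)) ≡ Σ m (λ j → Σ n (λ i → F i j))
Σ-swap zero    m F = sym (Σ-zero m _ (λ _ _ → refl))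
Σ-swap (suc n) m F = trans (cong (_+ Σ m (F n)) (Σ-swap n m F)) (sym (Σ-+ m _ _))

Σ-triangle : ∀ N (F : ℕ → ℕ → ℚ) →
  Σ N (λ k → Σ (suc k) (λ i → F i k)) ≡ Σ N (λ i → Σ (N ∸ i) (λ j → F i (i ℕ.+ j)))
Σ-triangle zero    F = refl
Σ-triangle (suc N) F = begin
  Σ N (λ k → Σ (suc k) (λ i → F i k)) + (Σ N (λ i → F i N) + F N N)
    ≡⟨ cong (_+ (Σ N (λ i → F i N) + F N N)) (Σ-triangle N F) ⟩
  Rows + (Σ N (λ i → F i N) + F N N)
    ≡⟨ sym (QP.+-assoc Rows (Σ N (λ i → F i N)) (F N N)) ⟩
  (Rows + Σ N (λ i → F i N)) + F N N
    ≡⟨ cong₂ _+_ (trans (sym (Σ-+ N _ _)) (Σ-cong N extendRow)) lastRow ⟩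
  Σ N (λ i → Σ (suc N ∸ i) (λ j → F i (i ℕ.+ j))) + Σ (suc N ∸ N) (λ j → F N (N ℕ.+ j)) ∎
  where
  Rows = Σ N (λ i → Σ (N ∸ i) (λ j → F i (i ℕ.+ j)))
  extendRow : ∀ i → i < N →
    Σ (N ∸ i) (λ j → F i (i ℕ.+ j)) + F i N ≡ Σ (suc N ∸ i) (λ j → F i (i ℕ.+ j))
  extendRow i i<N rewrite NP.+-∸-assoc 1 (NP.<⇒≤ i<N) =
    cong (λ x → Σ (N ∸ i) (λ j → F i (i ℕ.+ j)) + F i x) (sym (NP.m+[n∸m]≡n (NP.<⇒≤ i<N)))
  lastRow : F N N ≡ Σ (suc N ∸ N) (λ j → F N (N ℕ.+ j))
  lastRow rewrite NP.+-∸-assoc 1 (NP.≤-refl {N}) | NP.n∸n≡0 N | NP.+-identityʳ N =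
    sym (QP.+-identityˡ _)

_⋆_ : (ℕ → ℚ) → (ℕ → ℚ) → ℕ → ℚ
(f ⋆ g) n = Σ (suc n) (λ k → f k * g (n ∸ k))

δ : ℕ → ℚ
δ zero    = 1ℚ
δ (suc _) = 0ℚ

⋆-congʳ : ∀ f {g g′} n → (∀ k → g k ≡ g′ k) → (f ⋆ g) n ≡ (f ⋆ g′) n
⋆-congʳ f n e = Σ-cong′ (suc n) (λ k → cong (f k *_) (e (n ∸ k)))

⋆-assoc : ∀ f g h n → ((f ⋆ g) ⋆ h) n ≡ (f ⋆ (g ⋆ h)) n
⋆-assoc f g h n = begin
  Σ (suc n) (λ k → (f ⋆ g) k * h (n ∸ k))
    ≡⟨ Σ-cong′ (suc n) (λ k → Σ-*ʳ (suc k) (h (n ∸ k)) _) ⟩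
  Σ (suc n) (λ k → Σ (suc k) (λ i → A i k))
    ≡⟨ Σ-triangle (suc n) A ⟩
  Σ (suc n) (λ i → Σ (suc n ∸ i) (λ j → A i (i ℕ.+ j)))
    ≡⟨ Σ-cong (suc n) column ⟩
  Σ (suc n) (λ i → f i * (g ⋆ h) (n ∸ i)) ∎
  where
  A : ℕ → ℕ → ℚ
  A i k = (f i * g (k ∸ i)) * h (n ∸ k)
  column : ∀ i → i < suc n → Σ (suc n ∸ i) (λ j → A i (i ℕ.+ j)) ≡ f i * (g ⋆ h) (n ∸ i)
  column i (s≤s i≤n) = begin
    Σ (suc n ∸ i) (λ j → A i (i ℕ.+ j))
      ≡⟨ cong (λ M → Σ M (λ j → A i (i ℕ.+ j))) (NP.+-∸-assoc 1 i≤n) ⟩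
    Σ (suc (n ∸ i)) (λ j → A i (i ℕ.+ j))
      ≡⟨ Σ-cong′ (suc (n ∸ i)) (λ j → trans
           (cong₂ (λ a b → (f i * g a) * h b) (NP.m+n∸m≡n i j) (sym (NP.∸-+-assoc n i j)))
           (QP.*-assoc (f i) (g j) _)) ⟩
    Σ (suc (n ∸ i)) (λ j → f i * (g j * h (n ∸ i ∸ j)))
      ≡⟨ sym (Σ-*ˡ (suc (n ∸ i)) (f i) _) ⟩
    f i * (g ⋆ h) (n ∸ i) ∎

⋆-*ˡ : ∀ a f g n → ((λ k → a * f k) ⋆ g) n ≡ a * (f ⋆ g) n
⋆-*ˡ a f g n = trans (Σ-cong′ (suc n) (λ k → QP.*-assoc a (f k) (g (n ∸ k)))) (sym (Σ-*ˡ (suc n) a _))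

⋆-*ʳ : ∀ a f g n → (f ⋆ (λ k → a * g k)) n ≡ a * (f ⋆ g) n
⋆-*ʳ a f g n = trans (Σ-cong′ (suc n) (λ k → reorder (f k) (g (n ∸ k)))) (sym (Σ-*ˡ (suc n) a _))
  where
  reorder : ∀ x y → x * (a * y) ≡ a * (x * y)
  reorder = solve 3 (λ a x y → x :* (a :* y) := a :* (x :* y)) refl a

+-cancelˡ : ∀ a {x y} → a + x ≡ a + y → x ≡ y
+-cancelˡ a {x} {y} e = begin
  x               ≡⟨ solve 2 (λ a x → x := (:- a) :+ (a :+ x)) refl a x ⟩
  (- a) + (a + x) ≡⟨ cong (_+_ (- a)) e ⟩
  (- a) + (a + y) ≡⟨ solve 2 (λ a y → (:- a) :+ (a :+ y) := y) refl a y ⟩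
  y               ∎

⋆-cancelʳ : ∀ f g c w → c 0 * w ≡ 1ℚ → (∀ n → (f ⋆ c) n ≡ (g ⋆ c) n) → ∀ n → f n ≡ g n
⋆-cancelʳ f g c w c0w≡1 fc≡gc n = below (suc n) n NP.≤-refl
  where
  cancel-c0 : ∀ p q → p * c 0 ≡ q * c 0 → p ≡ q
  cancel-c0 p q e = begin
    p              ≡⟨ QP.*-identityʳ p ⟨
    p * 1ℚ         ≡⟨ cong (p *_) c0w≡1 ⟨
    p * (c 0 * w)  ≡⟨ QP.*-assoc p (c 0) w ⟨
    p * c 0 * w    ≡⟨ cong (_* w) e ⟩
    q * c 0 * w    ≡⟨ QP.*-assoc q (c 0) w ⟩
    q * (c 0 * w)  ≡⟨ cong (q *_) c0w≡1 ⟩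
    q * 1ℚ         ≡⟨ QP.*-identityʳ q ⟩
    q              ∎
  below : ∀ N k → k < N → f k ≡ g k
  below (suc N) k (s≤s k≤N) = cancel-c0 (f k) (g k) (+-cancelˡ (Σ k earlier) (begin
    Σ k earlier + f k * c 0
      ≡⟨ cong₂ _+_ (Σ-cong k agree) (cong (λ j → f k * c j) (NP.n∸n≡0 k)) ⟨
    (f ⋆ c) k
      ≡⟨ fc≡gc k ⟩
    (g ⋆ c) k
      ≡⟨ cong (λ j → Σ k earlier + g k * c j) (NP.n∸n≡0 k) ⟩
    Σ k earlier + g k * c 0 ∎))
    where
    earlier : ℕ → ℚ
    earlier i = g i * c (k ∸ i)
    agree : ∀ i → i < k → f i * c (k ∸ i) ≡ earlier i
    agree i i<k = cong (_* c (k ∸ i)) (below N i (NP.<-≤-trans i<k k≤N))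

Σ-interchange : ∀ N m (w v : ℕ → ℚ) (X : ℕ → ℕ → ℚ) →
  Σ N (λ n → w n * Σ m (λ i → v i * X n i)) ≡ Σ m (λ i → v i * Σ N (λ n → w n * X n i))
Σ-interchange N m w v X = begin
  Σ N (λ n → w n * Σ m (λ i → v i * X n i))
    ≡⟨ Σ-cong′ N (λ n → trans (Σ-*ˡ m (w n) _) (Σ-cong′ m (λ i → reorder (w n) (v i) (X n i)))) ⟩
  Σ N (λ n → Σ m (λ i → v i * (w n * X n i)))
    ≡⟨ Σ-swap N m _ ⟩
  Σ m (λ i → Σ N (λ n → v i * (w n * X n i)))
    ≡⟨ Σ-cong′ m (λ i → Σ-*ˡ N (v i) _) ⟨
  Σ m (λ i → v i * Σ N (λ n → w n * X n i)) ∎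
  where
  reorder : ∀ a b x → a * (b * x) ≡ b * (a * x)
  reorder = solve 3 (λ a b x → a :* (b :* x) := b :* (a :* x)) refl

pascal-sum : ∀ m (g : ℕ → ℚ) →
  Σ (suc (suc m)) (λ i → ℕ→ℚ (suc m C i) * g i) ≡ Σ (suc m) (λ i → ℕ→ℚ (m C i) * (g i + g (suc i)))
pascal-sum m g = begin
  Σ (suc (suc m)) (λ i → ℕ→ℚ (suc m C i) * g i)
    ≡⟨ Σ-first (suc m) _ ⟩
  ℕ→ℚ 1 * g 0 + Σ (suc m) (λ i → ℕ→ℚ (suc m C suc i) * g (suc i))
    ≡⟨ cong (_+_ (ℕ→ℚ 1 * g 0)) (trans (Σ-cong′ (suc m) pascal) (Σ-+ (suc m) _ _)) ⟩
  ℕ→ℚ 1 * g 0 + (X + (Y + ℕ→ℚ (m C suc m) * g (suc m)))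
    ≡⟨ cong (λ z → ℕ→ℚ 1 * g 0 + (X + (Y + ℕ→ℚ z * g (suc m)))) (k>n⇒nCk≡0 (NP.n<1+n m)) ⟩
  ℕ→ℚ 1 * g 0 + (X + (Y + ℕ→ℚ 0 * g (suc m)))
    ≡⟨ solve 4 (λ g₀ x y w → con 1ℚ :* g₀ :+ (x :+ (y :+ con 0ℚ :* w)) := (con 1ℚ :* g₀ :+ y) :+ x)
         refl (g 0) X Y (g (suc m)) ⟩
  (ℕ→ℚ 1 * g 0 + Y) + X
    ≡⟨ cong (_+ X) (Σ-first m (λ i → ℕ→ℚ (m C i) * g i)) ⟨
  Σ (suc m) (λ i → ℕ→ℚ (m C i) * g i) + X
    ≡⟨ trans (Σ-cong′ (suc m) (λ i → QP.*-distribˡ-+ (ℕ→ℚ (m C i)) (g i) (g (suc i)))) (Σ-+ (suc m) _ _) ⟨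
  Σ (suc m) (λ i → ℕ→ℚ (m C i) * (g i + g (suc i))) ∎
  where
  X = Σ (suc m) (λ i → ℕ→ℚ (m C i) * g (suc i))
  Y = Σ m (λ i → ℕ→ℚ (m C suc i) * g (suc i))
  pascal : ∀ i → ℕ→ℚ (suc m C suc i) * g (suc i) ≡ ℕ→ℚ (m C i) * g (suc i) + ℕ→ℚ (m C suc i) * g (suc i)
  pascal i = trans (cong (λ x → ℕ→ℚ x * g (suc i)) (sym (nCk+nC[k+1]≡[n+1]C[k+1] m i)))
             (trans (cong (_* g (suc i)) (ℕ→ℚ-+ (m C i) (m C suc i)))
                    (QP.*-distribʳ-+ (g (suc i)) (ℕ→ℚ (m C i)) (ℕ→ℚ (m C suc i))))

binomial : ∀ m y → Σ (suc m) (λ i → ℕ→ℚ (m C i) * y ^ℚ i) ≡ (1ℚ + y) ^ℚ m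
binomial zero    y = refl
binomial (suc m) y = begin
  Σ (suc (suc m)) (λ i → ℕ→ℚ (suc m C i) * y ^ℚ i)
    ≡⟨ pascal-sum m (λ i → y ^ℚ i) ⟩
  Σ (suc m) (λ i → ℕ→ℚ (m C i) * (y ^ℚ i + y * y ^ℚ i))
    ≡⟨ Σ-cong′ (suc m) (λ i → solve 3 (λ c a y → c :* (a :+ y :* a) := c :* a :+ y :* (c :* a))
                                        refl (ℕ→ℚ (m C i)) (y ^ℚ i) y) ⟩
  Σ (suc m) (λ i → ℕ→ℚ (m C i) * y ^ℚ i + y * (ℕ→ℚ (m C i) * y ^ℚ i))
    ≡⟨ trans (Σ-+ (suc m) _ _) (cong (_+_ S) (sym (Σ-*ˡ (suc m) y _))) ⟩
  S + y * S
    ≡⟨ cong (λ z → z + y * z) (binomial m y) ⟩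
  (1ℚ + y) ^ℚ m + y * (1ℚ + y) ^ℚ m
    ≡⟨ solve 2 (λ p y → p :+ y :* p := (con 1ℚ :+ y) :* p) refl ((1ℚ + y) ^ℚ m) y ⟩
  (1ℚ + y) ^ℚ suc m ∎
  where S = Σ (suc m) (λ i → ℕ→ℚ (m C i) * y ^ℚ i)

-- Finite differences.  diff n m = Σ_{k≤n} C(n,k) (-1)^k k^m is the n-th
-- forward difference of k ↦ k^m at 0, up to the sign (-1)^n.

signedPower : ℕ → ℕ → ℚ
signedPower m k = sign k * ℕ→ℚ k ^ℚ m

diff : ℕ → ℕ → ℚ
diff n m = Σ (suc n) (λ k → ℕ→ℚ (n C k) * signedPower m k)

signedPower-step : ∀ m k →
  signedPower m k + signedPower m (suc k) ≡ - Σ m (λ i → ℕ→ℚ (m C i) * signedPower i k)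
signedPower-step m k = begin
  sign k * ℕ→ℚ k ^ℚ m + sign (suc k) * ℕ→ℚ (suc k) ^ℚ m
    ≡⟨ cong₂ (λ a b → sign k * ℕ→ℚ k ^ℚ m + a * b ^ℚ m) (sign-suc k) (ℕ→ℚ-+ 1 k) ⟩
  sign k * ℕ→ℚ k ^ℚ m + (- sign k) * (1ℚ + ℕ→ℚ k) ^ℚ m
    ≡⟨ cong (λ z → sign k * ℕ→ℚ k ^ℚ m + (- sign k) * z) (sym (binomial m (ℕ→ℚ k))) ⟩
  sign k * ℕ→ℚ k ^ℚ m + (- sign k) * (S + ℕ→ℚ (m C m) * ℕ→ℚ k ^ℚ m)
    ≡⟨ cong (λ z → sign k * ℕ→ℚ k ^ℚ m + (- sign k) * (S + ℕ→ℚ z * ℕ→ℚ k ^ℚ m)) (nCn≡1 m) ⟩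
  sign k * ℕ→ℚ k ^ℚ m + (- sign k) * (S + 1ℚ * ℕ→ℚ k ^ℚ m)
    ≡⟨ solve 3 (λ s p S → s :* p :+ (:- s) :* (S :+ con 1ℚ :* p) := :- (s :* S)) refl (sign k) (ℕ→ℚ k ^ℚ m) S ⟩
  - (sign k * S)
    ≡⟨ cong -_ (trans (Σ-*ˡ m (sign k) _) (Σ-cong′ m (λ i →
         solve 3 (λ s c p → s :* (c :* p) := c :* (s :* p)) refl (sign k) (ℕ→ℚ (m C i)) (ℕ→ℚ k ^ℚ i)))) ⟩
  - Σ m (λ i → ℕ→ℚ (m C i) * signedPower i k) ∎
  where S = Σ m (λ i → ℕ→ℚ (m C i) * ℕ→ℚ k ^ℚ i)

diff-suc : ∀ n m → diff (suc n) m ≡ - Σ m (λ i → ℕ→ℚ (m C i) * diff n i)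
diff-suc n m = begin
  diff (suc n) m
    ≡⟨ pascal-sum n (signedPower m) ⟩
  Σ (suc n) (λ k → ℕ→ℚ (n C k) * (signedPower m k + signedPower m (suc k)))
    ≡⟨ Σ-cong′ (suc n) (λ k → cong (ℕ→ℚ (n C k) *_) (signedPower-step m k)) ⟩
  Σ (suc n) (λ k → ℕ→ℚ (n C k) * - Σ m (λ i → ℕ→ℚ (m C i) * signedPower i k))
    ≡⟨ Σ-neg-weighted (suc n) (λ k → ℕ→ℚ (n C k)) _ ⟩
  - Σ (suc n) (λ k → ℕ→ℚ (n C k) * Σ m (λ i → ℕ→ℚ (m C i) * signedPower i k))
    ≡⟨ cong -_ (Σ-interchange (suc n) m (λ k → ℕ→ℚ (n C k)) (λ i → ℕ→ℚ (m C i)) (λ k i → signedPower i k)) ⟩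
  - Σ m (λ i → ℕ→ℚ (m C i) * diff n i) ∎

diff-vanish : ∀ n m → m < n → diff n m ≡ 0ℚ
diff-vanish (suc n) m (s≤s m≤n) = trans (diff-suc n m) (cong -_ (Σ-zero m _ lower))
  where
  lower : ∀ i → i < m → ℕ→ℚ (m C i) * diff n i ≡ 0ℚ
  lower i i<m = trans (cong (ℕ→ℚ (m C i) *_) (diff-vanish n i (NP.<-≤-trans i<m m≤n)))
                      (QP.*-zeroʳ (ℕ→ℚ (m C i)))

diff-zero : ∀ m → diff 0 m ≡ δ m
diff-zero zero    = refl
diff-zero (suc m) = cong (λ z → 0ℚ + 1ℚ * (1ℚ * z)) (QP.*-zeroˡ (0ℚ ^ℚ m))

avg : ℕ → ℕ → ℚ
avg N m = Σ N (λ n → ½ ^ℚ suc n * diff n m)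

-- Only the terms n ≤ m contribute, so avg N m is constant once N > m.
avg-stable : ∀ N m → suc m ≤ N → avg N m ≡ avg (suc m) m
avg-stable (suc N) m (s≤s m≤N) with NP.m≤n⇒m<n∨m≡n m≤N
... | inj₂ refl = refl
... | inj₁ m<N  = trans (cong (avg N m +_) vanishing) (trans (QP.+-identityʳ _) (avg-stable N m m<N))
  where
  vanishing : ½ ^ℚ suc N * diff N m ≡ 0ℚ
  vanishing = trans (cong (½ ^ℚ suc N *_) (diff-vanish N m m<N)) (QP.*-zeroʳ (½ ^ℚ suc N))

double-half : ∀ n x → two * (½ ^ℚ suc (suc n) * x) ≡ ½ ^ℚ suc n * x
double-half n x = solve 2 (λ h x → con two :* (con ½ :* h :* x) := h :* x) refl (½ ^ℚ suc n) x

avg-suc : ∀ N m → two * avg (suc N) m ≡ δ m - Σ m (λ i → ℕ→ℚ (m C i) * avg N i)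
avg-suc N m = begin
  two * avg (suc N) m
    ≡⟨ cong (two *_) (Σ-first N (λ n → ½ ^ℚ suc n * diff n m)) ⟩
  two * (½ ^ℚ 1 * diff 0 m + Σ N (λ n → ½ ^ℚ suc (suc n) * diff (suc n) m))
    ≡⟨ QP.*-distribˡ-+ two (½ ^ℚ 1 * diff 0 m) (Σ N (λ n → ½ ^ℚ suc (suc n) * diff (suc n) m)) ⟩
  two * (½ ^ℚ 1 * diff 0 m) + two * Σ N (λ n → ½ ^ℚ suc (suc n) * diff (suc n) m)
    ≡⟨ cong₂ _+_ (trans (double-half-1 (diff 0 m)) (diff-zero m))
                 (trans (Σ-*ˡ N two _) (Σ-cong′ N (λ n → trans (double-half n (diff (suc n) m))
                                                         (cong (½ ^ℚ suc n *_) (diff-suc n m))))) ⟩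
  δ m + Σ N (λ n → ½ ^ℚ suc n * - Σ m (λ i → ℕ→ℚ (m C i) * diff n i))
    ≡⟨ cong (δ m +_) (Σ-neg-weighted N (λ n → ½ ^ℚ suc n) _) ⟩
  δ m - Σ N (λ n → ½ ^ℚ suc n * Σ m (λ i → ℕ→ℚ (m C i) * diff n i))
    ≡⟨ cong (_-_ (δ m)) (Σ-interchange N m (λ n → ½ ^ℚ suc n) (λ i → ℕ→ℚ (m C i)) diff) ⟩
  δ m - Σ m (λ i → ℕ→ℚ (m C i) * avg N i) ∎
  where
  double-half-1 : ∀ x → two * (½ ^ℚ 1 * x) ≡ x
  double-half-1 = solve 1 (λ x → con two :* (con ½ :* con 1ℚ :* x) := x) refl

E : ℕ → ℚ
E m = avg (suc m) m

E-rec : ∀ m → two * E m ≡ δ m - Σ m (λ i → ℕ→ℚ (m C i) * E i)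
E-rec m = begin
  two * avg (suc m) m
    ≡⟨ cong (two *_) (avg-stable (suc (suc m)) m (NP.n≤1+n _)) ⟨
  two * avg (suc (suc m)) m
    ≡⟨ avg-suc (suc m) m ⟩
  δ m - Σ m (λ i → ℕ→ℚ (m C i) * avg (suc m) i)
    ≡⟨ cong (_-_ (δ m)) (Σ-cong m (λ i i<m → cong (ℕ→ℚ (m C i) *_) (avg-stable (suc m) i (s≤s (NP.<⇒≤ i<m))))) ⟩
  δ m - Σ m (λ i → ℕ→ℚ (m C i) * E i) ∎

invFact : ℕ → ℚ
invFact j = (ℤ.+ 1 / j !) {{j !≢0}}

invFact-inverse : ∀ j → invFact j * ℕ→ℚ (j !) ≡ 1ℚ
invFact-inverse j = recip-inverse (j !) {{j !≢0}}

C-factorials : ∀ {m i} → i ≤ m → (m C i) ℕ.* ((i !) ℕ.* ((m ∸ i) !)) ≡ m !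
C-factorials {m} {i} i≤m =
  trans (cong (ℕ._* ((i !) ℕ.* ((m ∸ i) !))) (nCk≡n!/k![n-k]! i≤m)) (ND.m/n*n≡m (k![n∸k]!∣n! i≤m))
  where instance _ = i !* (m ∸ i) !≢0

-- 1/i! · 1/(m-i)! = C(m,i)/m!: the product rule for exponential generating functions.
invFact-binomial : ∀ {m i} → i ≤ m → invFact i * invFact (m ∸ i) ≡ ℕ→ℚ (m C i) * invFact m
invFact-binomial {m} {i} i≤m = begin
  x * y
    ≡⟨ solve 2 (λ x y → x :* y := x :* y :* con 1ℚ) refl x y ⟩
  x * y * 1ℚ
    ≡⟨ cong (x * y *_) (invFact-inverse m) ⟨
  x * y * (invFact m * ℕ→ℚ (m !))
    ≡⟨ cong (λ z → x * y * (invFact m * z)) factorials ⟨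
  x * y * (invFact m * (ℕ→ℚ (m C i) * (ℕ→ℚ (i !) * ℕ→ℚ ((m ∸ i) !))))
    ≡⟨ solve 6 (λ a b c d e f → a :* b :* (c :* (d :* (e :* f))) := (d :* c) :* (a :* e) :* (b :* f))
         refl x y (invFact m) (ℕ→ℚ (m C i)) (ℕ→ℚ (i !)) (ℕ→ℚ ((m ∸ i) !)) ⟩
  (ℕ→ℚ (m C i) * invFact m) * (x * ℕ→ℚ (i !)) * (y * ℕ→ℚ ((m ∸ i) !))
    ≡⟨ cong₂ (λ p q → (ℕ→ℚ (m C i) * invFact m) * p * q) (invFact-inverse i) (invFact-inverse (m ∸ i)) ⟩
  (ℕ→ℚ (m C i) * invFact m) * 1ℚ * 1ℚ
    ≡⟨ solve 1 (λ a → a :* con 1ℚ :* con 1ℚ := a) refl (ℕ→ℚ (m C i) * invFact m) ⟩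
  ℕ→ℚ (m C i) * invFact m ∎
  where
  x = invFact i
  y = invFact (m ∸ i)
  factorials : ℕ→ℚ (m C i) * (ℕ→ℚ (i !) * ℕ→ℚ ((m ∸ i) !)) ≡ ℕ→ℚ (m !)
  factorials = trans (cong (ℕ→ℚ (m C i) *_) (sym (ℕ→ℚ-* (i !) ((m ∸ i) !))))
                     (trans (sym (ℕ→ℚ-* (m C i) _)) (cong ℕ→ℚ (C-factorials i≤m)))

b : ℕ → ℚ
b n = lookup (bVec n) (fromℕ n)

lookup-∷ʳ-last : ∀ {n} (xs : Vec ℚ n) y → lookup (xs ∷ʳ y) (fromℕ n) ≡ y
lookup-∷ʳ-last []       y = refl
lookup-∷ʳ-last (_ ∷ xs) y = lookup-∷ʳ-last xs y

lookup-∷ʳ : ∀ {n} (xs : Vec ℚ n) y (F : ℕ → ℚ) → (∀ j → lookup xs j ≡ F (toℕ j)) → y ≡ F n →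
  ∀ k → lookup (xs ∷ʳ y) k ≡ F (toℕ k)
lookup-∷ʳ []       y F xs≡F y≡F fzero    = y≡F
lookup-∷ʳ (_ ∷ xs) y F xs≡F y≡F fzero    = xs≡F fzero
lookup-∷ʳ (_ ∷ xs) y F xs≡F y≡F (fsuc k) = lookup-∷ʳ xs y (λ j → F (suc j)) (λ j → xs≡F (fsuc j)) y≡F k

bNext : ℕ → ℚ
bNext n = - foldr′ _+_ 0ℚ (tabulate (λ (k : Fin (suc n)) → lookup (bVec n) k * expCoeff (suc n ∸ toℕ k)))

bVec-lookup : ∀ n k → lookup (bVec n) k ≡ b (toℕ k)
bVec-lookup zero    fzero = refl
bVec-lookup (suc n) k =
  lookup-∷ʳ (bVec n) (bNext n) b (bVec-lookup n) (sym (lookup-∷ʳ-last (bVec n) (bNext n))) k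

foldr-tabulate : ∀ n (h : Fin n → ℚ) (h′ : ℕ → ℚ) → (∀ k → h k ≡ h′ (toℕ k)) →
  foldr′ _+_ 0ℚ (tabulate h) ≡ Σ n h′
foldr-tabulate zero    h h′ h≡h′ = refl
foldr-tabulate (suc n) h h′ h≡h′ = trans
  (cong₂ _+_ (h≡h′ fzero) (foldr-tabulate n (λ k → h (fsuc k)) (λ k → h′ (suc k)) (λ k → h≡h′ (fsuc k))))
  (sym (Σ-first n h′))

b-suc : ∀ n → b (suc n) ≡ - Σ (suc n) (λ k → b k * expCoeff (suc n ∸ k))
b-suc n = trans (lookup-∷ʳ-last (bVec n) (bNext n))
  (cong -_ (foldr-tabulate (suc n) _ _ (λ k → cong (_* expCoeff (suc n ∸ toℕ k)) (bVec-lookup n k))))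

b⋆expCoeff : ∀ n → (b ⋆ expCoeff) n ≡ δ n
b⋆expCoeff zero    = refl
b⋆expCoeff (suc n) = begin
  S + b (suc n) * expCoeff (suc n ∸ suc n)
    ≡⟨ cong (λ z → S + b (suc n) * expCoeff z) (NP.n∸n≡0 n) ⟩
  S + b (suc n) * 1ℚ
    ≡⟨ cong (λ z → S + z * 1ℚ) (b-suc n) ⟩
  S + (- S) * 1ℚ
    ≡⟨ solve 1 (λ s → s :+ (:- s) :* con 1ℚ := con 0ℚ) refl S ⟩
  0ℚ ∎
  where S = Σ (suc n) (λ k → b k * expCoeff (suc n ∸ k))

-- Generating-function identities.  'dilate f' is f(2t); 'onePlusExp' is 1 + e^t.

dilate : (ℕ → ℚ) → ℕ → ℚ
dilate f n = two ^ℚ n * f n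

dilate-⋆ : ∀ f h n → (dilate f ⋆ dilate h) n ≡ dilate (f ⋆ h) n
dilate-⋆ f h n = sym (trans (Σ-*ˡ (suc n) (two ^ℚ n) _) (Σ-cong (suc n) term))
  where
  term : ∀ k → k < suc n → two ^ℚ n * (f k * h (n ∸ k)) ≡ dilate f k * dilate h (n ∸ k)
  term k (s≤s k≤n) = begin
    two ^ℚ n * (f k * h (n ∸ k))
      ≡⟨ cong (λ z → two ^ℚ z * (f k * h (n ∸ k))) (NP.m+[n∸m]≡n k≤n) ⟨
    two ^ℚ (k ℕ.+ (n ∸ k)) * (f k * h (n ∸ k))
      ≡⟨ cong (_* (f k * h (n ∸ k))) (^ℚ-+ two k (n ∸ k)) ⟨
    two ^ℚ k * two ^ℚ (n ∸ k) * (f k * h (n ∸ k))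
      ≡⟨ solve 4 (λ p q a b → p :* q :* (a :* b) := p :* a :* (q :* b)) refl
           (two ^ℚ k) (two ^ℚ (n ∸ k)) (f k) (h (n ∸ k)) ⟩
    dilate f k * dilate h (n ∸ k) ∎

dilate-δ : ∀ n → dilate δ n ≡ δ n
dilate-δ zero    = refl
dilate-δ (suc n) = QP.*-zeroʳ (two ^ℚ suc n)

onePlusExp : ℕ → ℚ
onePlusExp zero    = two
onePlusExp (suc j) = expCoeff j

binomial-sum : ∀ n → two + Σ n (λ k → ℕ→ℚ (suc n C suc k)) ≡ two ^ℚ suc n
binomial-sum n = begin
  two + Σ n (λ k → ℕ→ℚ (suc n C suc k))
    ≡⟨ solve 1 (λ S → con two :+ S := (con 1ℚ :+ S) :+ con 1ℚ) refl (Σ n (λ k → ℕ→ℚ (suc n C suc k))) ⟩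
  (1ℚ + Σ n (λ k → ℕ→ℚ (suc n C suc k))) + 1ℚ
    ≡⟨ cong₂ (λ p q → (1ℚ + p) + q) (Σ-cong′ n (λ k → term (suc n C suc k) (suc k))) lastTerm ⟩
  (1ℚ + Σ n (λ k → ℕ→ℚ (suc n C suc k) * 1ℚ ^ℚ suc k)) + ℕ→ℚ (suc n C suc n) * 1ℚ ^ℚ suc n
    ≡⟨ QP.+-assoc 1ℚ (Σ n (λ k → ℕ→ℚ (suc n C suc k) * 1ℚ ^ℚ suc k)) (ℕ→ℚ (suc n C suc n) * 1ℚ ^ℚ suc n) ⟩
  1ℚ + Σ (suc n) (λ k → ℕ→ℚ (suc n C suc k) * 1ℚ ^ℚ suc k)
    ≡⟨ Σ-first (suc n) (λ i → ℕ→ℚ (suc n C i) * 1ℚ ^ℚ i) ⟨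
  Σ (suc (suc n)) (λ i → ℕ→ℚ (suc n C i) * 1ℚ ^ℚ i)
    ≡⟨ binomial (suc n) 1ℚ ⟩
  two ^ℚ suc n ∎
  where
  term : ∀ c i → ℕ→ℚ c ≡ ℕ→ℚ c * 1ℚ ^ℚ i
  term c i = sym (trans (cong (ℕ→ℚ c *_) (1^ℚ i)) (QP.*-identityʳ _))
  lastTerm : 1ℚ ≡ ℕ→ℚ (suc n C suc n) * 1ℚ ^ℚ suc n
  lastTerm = trans (term 1 (suc n)) (cong (λ c → ℕ→ℚ c * 1ℚ ^ℚ suc n) (sym (nCn≡1 (suc n))))

-- (1 + e^t) · (e^t - 1)/t = (e^{2t} - 1)/t = 2 · [(e^s - 1)/s at s = 2t].
onePlusExp⋆expCoeff : ∀ n → (onePlusExp ⋆ expCoeff) n ≡ two * dilate expCoeff n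
onePlusExp⋆expCoeff n = begin
  (onePlusExp ⋆ expCoeff) n
    ≡⟨ Σ-first n (λ k → onePlusExp k * expCoeff (n ∸ k)) ⟩
  two * e + Σ n (λ k → invFact (suc k) * invFact (suc (n ∸ suc k)))
    ≡⟨ cong (_+_ (two * e)) (trans (Σ-cong n product) (sym (Σ-*ʳ n e _))) ⟩
  two * e + Σ n (λ k → ℕ→ℚ (suc n C suc k)) * e
    ≡⟨ QP.*-distribʳ-+ e two (Σ n (λ k → ℕ→ℚ (suc n C suc k))) ⟨
  (two + Σ n (λ k → ℕ→ℚ (suc n C suc k))) * e
    ≡⟨ cong (_* e) (binomial-sum n) ⟩
  two ^ℚ suc n * e
    ≡⟨ QP.*-assoc two (two ^ℚ n) e ⟩
  two * dilate expCoeff n ∎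
  where
  e = expCoeff n
  product : ∀ k → k < n → invFact (suc k) * invFact (suc (n ∸ suc k)) ≡ ℕ→ℚ (suc n C suc k) * e
  product k k<n = trans (cong (λ z → invFact (suc k) * invFact z) (sym (NP.+-∸-assoc 1 k<n)))
                        (invFact-binomial (s≤s (NP.<⇒≤ k<n)))

-- β(2t) (1 + e^t) = 2 β(t), obtained by cancelling (e^t - 1)/t from
-- β(2t) (1 + e^t) (e^t - 1)/t = 2 β(2t) (e^{2t} - 1)/(2t) = 2 = 2 β(t) (e^t - 1)/t.
dilate-b⋆onePlusExp : ∀ n → (dilate b ⋆ onePlusExp) n ≡ two * b n
dilate-b⋆onePlusExp = ⋆-cancelʳ (dilate b ⋆ onePlusExp) (λ k → two * b k) expCoeff 1ℚ refl times-expCoeff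
  where
  times-expCoeff : ∀ n → ((dilate b ⋆ onePlusExp) ⋆ expCoeff) n ≡ ((λ k → two * b k) ⋆ expCoeff) n
  times-expCoeff n = begin
    ((dilate b ⋆ onePlusExp) ⋆ expCoeff) n
      ≡⟨ ⋆-assoc (dilate b) onePlusExp expCoeff n ⟩
    (dilate b ⋆ (onePlusExp ⋆ expCoeff)) n
      ≡⟨ ⋆-congʳ (dilate b) n onePlusExp⋆expCoeff ⟩
    (dilate b ⋆ (λ k → two * dilate expCoeff k)) n
      ≡⟨ ⋆-*ʳ two (dilate b) (dilate expCoeff) n ⟩
    two * (dilate b ⋆ dilate expCoeff) n
      ≡⟨ cong (two *_) (trans (dilate-⋆ b expCoeff n) (cong (two ^ℚ n *_) (b⋆expCoeff n))) ⟩
    two * dilate δ n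
      ≡⟨ cong (two *_) (trans (dilate-δ n) (sym (b⋆expCoeff n))) ⟩
    two * (b ⋆ expCoeff) n
      ≡⟨ ⋆-*ˡ two b expCoeff n ⟨
    ((λ k → two * b k) ⋆ expCoeff) n ∎

b⋆onePlusExp : ∀ m → (b ⋆ onePlusExp) (suc m) ≡ two * b (suc m) + δ m
b⋆onePlusExp m = begin
  Σ (suc m) (λ k → b k * onePlusExp (suc m ∸ k)) + b (suc m) * onePlusExp (suc m ∸ suc m)
    ≡⟨ cong₂ _+_ (Σ-cong (suc m) (λ k k≤m → cong (λ z → b k * onePlusExp z) (NP.+-∸-assoc 1 (NP.≤-pred k≤m))))
                 (cong (λ z → b (suc m) * onePlusExp z) (NP.n∸n≡0 m)) ⟩
  (b ⋆ expCoeff) m + b (suc m) * two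
    ≡⟨ cong₂ _+_ (b⋆expCoeff m) (QP.*-comm (b (suc m)) two) ⟩
  δ m + two * b (suc m)
    ≡⟨ QP.+-comm (δ m) _ ⟩
  two * b (suc m) + δ m ∎

-- ρ(t) = (β(t) - β(2t))/t, the candidate for Σ E_m t^m / m!.
ρ : ℕ → ℚ
ρ m = b (suc m) - dilate b (suc m)

ρ⋆onePlusExp : ∀ m → (ρ ⋆ onePlusExp) m ≡ δ m
ρ⋆onePlusExp m = begin
  (ρ ⋆ onePlusExp) m
    ≡⟨ trans (cong (_+ (ρ ⋆ onePlusExp) m) (QP.*-zeroˡ (onePlusExp (suc m)))) (QP.+-identityˡ _) ⟨
  0ℚ * onePlusExp (suc m) + (ρ ⋆ onePlusExp) m
    ≡⟨ Σ-first (suc m) (λ k → β-β₂ k * onePlusExp (suc m ∸ k)) ⟨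
  (β-β₂ ⋆ onePlusExp) (suc m)
    ≡⟨ Σ-cong′ (suc (suc m)) (λ k → distrib (b k) (dilate b k) (onePlusExp (suc m ∸ k))) ⟩
  Σ (suc (suc m)) (λ k → b k * onePlusExp (suc m ∸ k) + -1ℚ * dilate b k * onePlusExp (suc m ∸ k))
    ≡⟨ Σ-+ (suc (suc m)) _ _ ⟩
  (b ⋆ onePlusExp) (suc m) + ((λ k → -1ℚ * dilate b k) ⋆ onePlusExp) (suc m)
    ≡⟨ cong₂ _+_ (b⋆onePlusExp m) (trans (⋆-*ˡ -1ℚ (dilate b) onePlusExp (suc m))
                                           (cong (-1ℚ *_) (dilate-b⋆onePlusExp (suc m)))) ⟩
  (two * b (suc m) + δ m) + -1ℚ * (two * b (suc m))
    ≡⟨ solve 2 (λ p d → (p :+ d) :+ con -1ℚ :* p := d) refl (two * b (suc m)) (δ m) ⟩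
  δ m ∎
  where
  -1ℚ = - 1ℚ
  β-β₂ : ℕ → ℚ
  β-β₂ k = b k - dilate b k
  distrib : ∀ x y o → (x - y) * o ≡ x * o + -1ℚ * y * o
  distrib = solve 3 (λ x y o → (x :- y) :* o := x :* o :+ con -1ℚ :* y :* o) refl

-- The exponential generating function of E: the recursion E-rec says exactly
-- (Σ E_m t^m/m!) (1 + e^t) = 1.
egfE : ℕ → ℚ
egfE m = invFact m * E m

egfE⋆onePlusExp : ∀ m → (egfE ⋆ onePlusExp) m ≡ δ m
egfE⋆onePlusExp m = begin
  Σ m (λ i → egfE i * onePlusExp (m ∸ i)) + egfE m * onePlusExp (m ∸ m)
    ≡⟨ cong₂ _+_ (trans (Σ-cong m term) (sym (Σ-*ˡ m (invFact m) _)))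
                 (cong (λ z → egfE m * onePlusExp z) (NP.n∸n≡0 m)) ⟩
  invFact m * S + invFact m * E m * two
    ≡⟨ solve 4 (λ x S e t → x :* S :+ x :* e :* t := x :* (t :* e :+ S)) refl (invFact m) S (E m) two ⟩
  invFact m * (two * E m + S)
    ≡⟨ cong (λ z → invFact m * (z + S)) (E-rec m) ⟩
  invFact m * ((δ m - S) + S)
    ≡⟨ cong (invFact m *_) (solve 2 (λ d S → (d :- S) :+ S := d) refl (δ m) S) ⟩
  invFact m * δ m
    ≡⟨ invFact-δ m ⟩
  δ m ∎
  where
  S = Σ m (λ i → ℕ→ℚ (m C i) * E i)
  invFact-δ : ∀ m → invFact m * δ m ≡ δ m
  invFact-δ zero    = refl
  invFact-δ (suc m) = QP.*-zeroʳ (invFact (suc m))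
  term : ∀ i → i < m → egfE i * onePlusExp (m ∸ i) ≡ invFact m * (ℕ→ℚ (m C i) * E i)
  term i i<m = begin
    invFact i * E i * onePlusExp (m ∸ i)
      ≡⟨ trans (cong (λ z → invFact i * E i * onePlusExp z) shift)
               (cong (λ z → invFact i * E i * invFact z) (sym shift)) ⟩
    invFact i * E i * invFact (m ∸ i)
      ≡⟨ solve 3 (λ a e c → a :* e :* c := a :* c :* e) refl (invFact i) (E i) (invFact (m ∸ i)) ⟩
    invFact i * invFact (m ∸ i) * E i
      ≡⟨ cong (_* E i) (invFact-binomial (NP.<⇒≤ i<m)) ⟩
    ℕ→ℚ (m C i) * invFact m * E i
      ≡⟨ solve 3 (λ c x e → c :* x :* e := x :* (c :* e)) refl (ℕ→ℚ (m C i)) (invFact m) (E i) ⟩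
    invFact m * (ℕ→ℚ (m C i) * E i) ∎
    where
    shift : m ∸ i ≡ suc (m ∸ suc i)
    shift = NP.+-∸-assoc 1 i<m

-- Both egfE and ρ invert 1 + e^t, whose constant term 2 is invertible.
egfE≡ρ : ∀ m → egfE m ≡ ρ m
egfE≡ρ = ⋆-cancelʳ egfE ρ onePlusExp ½ refl (λ n → trans (egfE⋆onePlusExp n) (sym (ρ⋆onePlusExp n)))

rhsCoeff : ℕ → ℚ
rhsCoeff m = (1ℚ - two ^ℚ suc m) * (ℤ.+ 1 / suc m) * bernoulli (suc m)

E≡rhsCoeff : ∀ m → E m ≡ rhsCoeff m
E≡rhsCoeff m = begin
  E m
    ≡⟨ QP.*-identityˡ (E m) ⟨
  1ℚ * E m
    ≡⟨ cong (_* E m) (trans (QP.*-comm (ℕ→ℚ (m !)) (invFact m)) (invFact-inverse m)) ⟨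
  ℕ→ℚ (m !) * invFact m * E m
    ≡⟨ QP.*-assoc (ℕ→ℚ (m !)) (invFact m) (E m) ⟩
  ℕ→ℚ (m !) * egfE m
    ≡⟨ cong (ℕ→ℚ (m !) *_) (egfE≡ρ m) ⟩
  ℕ→ℚ (m !) * (β - T * β)
    ≡⟨ solve 3 (λ f β t → f :* (β :- t :* β) := (con 1ℚ :- t) :* con 1ℚ :* (f :* β)) refl (ℕ→ℚ (m !)) β T ⟩
  (1ℚ - T) * 1ℚ * (ℕ→ℚ (m !) * β)
    ≡⟨ cong (λ z → (1ℚ - T) * z * (ℕ→ℚ (m !) * β)) (recip-inverse (suc m)) ⟨
  (1ℚ - T) * (y * ℕ→ℚ (suc m)) * (ℕ→ℚ (m !) * β)
    ≡⟨ solve 5 (λ a y n f β → a :* (y :* n) :* (f :* β) := a :* y :* (n :* f :* β))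
         refl (1ℚ - T) y (ℕ→ℚ (suc m)) (ℕ→ℚ (m !)) β ⟩
  (1ℚ - T) * y * (ℕ→ℚ (suc m) * ℕ→ℚ (m !) * β)
    ≡⟨ cong (λ z → (1ℚ - T) * y * (z * β)) (ℕ→ℚ-* (suc m) (m !)) ⟨
  rhsCoeff m ∎
  where
  β = b (suc m)
  T = two ^ℚ suc m
  y = ℤ.+ 1 / suc m

bracketCoeff : ℕ → ℕ → ℚ
bracketCoeff n m = Σ (suc n) (λ k → ℤ→ℚ ((-1ℤ ℤ.^ k) ℤ.* ℤ.+ (n C k)) * ℤ→ℚ (ℤ.+ (k ℕ.^ m)))

bracketCoeff≡diff : ∀ n m → bracketCoeff n m ≡ diff n m
bracketCoeff≡diff n m = Σ-cong′ (suc n) (λ k →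
  trans (cong₂ _*_ (ℤ→ℚ-* (-1ℤ ℤ.^ k) (ℤ.+ (n C k))) (ℕ→ℚ-^ k m))
        (solve 3 (λ s c p → s :* c :* p := c :* (s :* p)) refl (sign k) (ℕ→ℚ (n C k)) (ℕ→ℚ k ^ℚ m)))

module Transport {c ℓ : Level} (R : CommutativeRing c ℓ) (ι : ℚ → CommutativeRing.Carrier R)
  (ι-hom : IsRingHomomorphism Q.+-*-rawRing (CommutativeRing.rawRing R) ι) where
  open CommutativeRing R
    using (Carrier; _≈_; +-cong; *-congˡ; *-congʳ; *-assoc; distribʳ; zeroˡ)
    renaming (refl to ≈-refl; sym to ≈-sym; trans to ≈-trans; reflexive to ≈-reflexive;
              _+_ to _+ᴿ_; _*_ to _*ᴿ_)
  open IsRingHomomorphism ι-hom using (+-homo; *-homo; 0#-homo)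
  open Series R ι using (ΣR; bracket; lhsPartial; rhs)

  ΣR-cong : ∀ n {f g} → (∀ k → f k ≈ g k) → ΣR n f ≈ ΣR n g
  ΣR-cong zero    f≈g = ≈-refl
  ΣR-cong (suc n) f≈g = +-cong (ΣR-cong n f≈g) (f≈g n)

  ΣR-ι : ∀ n (f : ℕ → ℚ) x → ΣR n (λ k → ι (f k) *ᴿ x) ≈ ι (Σ n f) *ᴿ x
  ΣR-ι zero    f x = ≈-sym (≈-trans (*-congʳ 0#-homo) (zeroˡ x))
  ΣR-ι (suc n) f x = ≈-trans (+-cong (ΣR-ι n f x) ≈-refl)
                     (≈-trans (≈-sym (distribʳ x _ _)) (*-congʳ (≈-sym (+-homo (Σ n f) (f n)))))

  ι-*-assoc : ∀ p q x → ι p *ᴿ (ι q *ᴿ x) ≈ ι (p * q) *ᴿ x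
  ι-*-assoc p q x = ≈-trans (≈-sym (*-assoc _ _ _)) (*-congʳ (≈-sym (*-homo p q)))

  bracket-coeff : ∀ a n m → bracket a n m ≈ ι (bracketCoeff n m) *ᴿ a m
  bracket-coeff a n m = ≈-trans (ΣR-cong (suc n) (λ k → ι-*-assoc _ _ (a m))) (ΣR-ι (suc n) _ (a m))

  lhsPartial-coeff : ∀ a N m → lhsPartial a N m ≈ ι (avg N m) *ᴿ a m
  lhsPartial-coeff a N m = ≈-trans
    (ΣR-cong N (λ n → ≈-trans (*-congˡ (bracket-coeff a n m)) (ι-*-assoc _ _ (a m))))
    (≈-trans (ΣR-ι N _ (a m)) (*-congʳ (≈-reflexive (cong ι (Σ-cong′ N (λ n →
      cong (½ ^ℚ suc n *_) (bracketCoeff≡diff n m)))))))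

  rhs-coeff : ∀ a m → rhs a m ≈ ι (rhsCoeff m) *ᴿ a m
  rhs-coeff a m = ≈-refl

corollary3 : {c ℓ : Level} (R : CommutativeRing c ℓ)
    (ι : ℚ → CommutativeRing.Carrier R) →
    IsRingHomomorphism Q.+-*-rawRing (CommutativeRing.rawRing R) ι →
    (a : ℕ → CommutativeRing.Carrier R) →
    (m : ℕ) → ∃ λ N → (N′ : ℕ) → N ≤ N′ →
    CommutativeRing._≈_ R (Series.lhsPartial R ι a N′ m) (Series.rhs R ι a m)
corollary3 R ι ι-hom a m = suc m , λ N′ m<N′ →
  ≈-trans (lhsPartial-coeff a N′ m)
  (≈-trans (*-congʳ (≈-reflexive (cong ι (begin
             avg N′ m    ≡⟨ avg-stable N′ m m<N′ ⟩
             E m         ≡⟨ E≡rhsCoeff m ⟩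
             rhsCoeff m  ∎))))
           (≈-sym (rhs-coeff a m)))
  where
  open Transport R ι ι-hom
  open CommutativeRing R using (*-congʳ)
    renaming (sym to ≈-sym; trans to ≈-trans; reflexive to ≈-reflexive)
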